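{- If $G$ is a connected, well-dominated graph of order at least $2$ that has an isolatable vertex, then $G \,\square\, H$ is not well-dominated for any connected graph $H$ of order at least $2$.
   Context: All graphs are finite, simple and undirected. $\gamma(X)$ is the minimum size of a dominating set (a set $D$ with every vertex in $D$ or adjacent to a vertex of $D$), $\Gamma(X)$ the maximum size of an inclusion-minimal dominating set; $X$ is well-dominated if $\gamma(X)=\Gamma(X)$. A vertex $x$ of $X$ is isolatable if there is an independent set $I$ of $X$ such that $x$ is an isolated vertex of the induced subgraph $X-N[I]$, where $N[I]$ is $I$ together with all neighbors of vertices of $I$. The Cartesian product $G\,\square\, H$ has vertex set $V(G)\times V(H)$, with $(g_1,h_1)\sim(g_2,h_2)$ iff either $g_1=g_2$ and $h_1h_2\in E(H)$, or $h_1=h_2$ and $g_1g_2\in E(G)$. -}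

module Defs where

open import Data.Nat using (ℕ; _*_; _≤_; _<_)
open import Data.Fin using (Fin; remQuot)
open import Data.Fin.Subset using (Subset; _∈_; _∉_; ∣_∣)
open import Data.Bool using (Bool; true; false; _∧_; _∨_)
open import Data.Product using (Σ; ∃; _×_; _,_; proj₁; proj₂)
open import Data.Sum using (_⊎_)
open import Relation.Binary.PropositionalEquality using (_≡_; _≢_)
open import Relation.Nullary using (¬_)

record Graph : Set where
  constructor mkGraph
  field
    n     : ℕ
    adj   : Fin n → Fin n → Bool
open Graph public

Simple : Graph → Set
Simple G = (∀ u v → adj G u v ≡ adj G v u) × (∀ v → adj G v v ≡ false)

order : Graph → ℕ
order G = n G

Adj : (G : Graph) → Fin (n G) → Fin (n G) → Set
Adj G u v = adj G u v ≡ true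

data Reach (G : Graph) : Fin (n G) → Fin (n G) → Set where
  here : ∀ {u} → Reach G u u
  step : ∀ {u v w} → Adj G u v → Reach G v w → Reach G u w

Connected : Graph → Set
Connected G = ∀ u v → Reach G u v

Dominates : (G : Graph) → Subset (n G) → Fin (n G) → Set
Dominates G D v = v ∈ D ⊎ (∃ λ u → u ∈ D × Adj G u v)

Dominating : (G : Graph) → Subset (n G) → Set
Dominating G D = ∀ v → Dominates G D v

_⊊_ : ∀ {k} → Subset k → Subset k → Set
A ⊊ B = (∀ x → x ∈ A → x ∈ B) × (∃ λ x → x ∈ B × x ∉ A)

MinimalDominating : (G : Graph) → Subset (n G) → Set
MinimalDominating G D = Dominating G D × (∀ D' → D' ⊊ D → ¬ Dominating G D')

IsDominationNumber : Graph → ℕ → Set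
IsDominationNumber G k =
  (∃ λ D → Dominating G D × ∣ D ∣ ≡ k) × (∀ D → Dominating G D → k ≤ ∣ D ∣)

IsUpperDominationNumber : Graph → ℕ → Set
IsUpperDominationNumber G k =
  (∃ λ D → MinimalDominating G D × ∣ D ∣ ≡ k) × (∀ D → MinimalDominating G D → ∣ D ∣ ≤ k)

WellDominated : Graph → Set
WellDominated G = ∃ λ k → IsDominationNumber G k × IsUpperDominationNumber G k

Independent : (G : Graph) → Subset (n G) → Set
Independent G I = ∀ u v → u ∈ I → v ∈ I → ¬ Adj G u v

InClosedNbhd : (G : Graph) → Subset (n G) → Fin (n G) → Set
InClosedNbhd G I v = Dominates G I v

-- x is isolatable: some independent I with x ∉ N[I] and every neighbour of x in N[I]
-- (i.e. x is an isolated vertex of G - N[I])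
Isolatable : (G : Graph) → Fin (n G) → Set
Isolatable G x = ∃ λ I → Independent G I × ¬ InClosedNbhd G I x
                   × (∀ y → Adj G x y → InClosedNbhd G I y)

-- Cartesian product G □ H on Fin (n G * n H), vertex i ↔ remQuot i = (g , h)
prodAdj : (G H : Graph) → Fin (n G * n H) → Fin (n G * n H) → Bool
prodAdj G H i j with remQuot (n H) i | remQuot (n H) j
... | (g₁ , h₁) | (g₂ , h₂) =
  (eqF g₁ g₂ ∧ adj H h₁ h₂) ∨ (eqF h₁ h₂ ∧ adj G g₁ g₂)
  where
  open import Data.Fin using (_≟_)
  open import Relation.Nullary.Decidable using (⌊_⌋)
  eqF : ∀ {m} → Fin m → Fin m → Bool
  eqF a b = ⌊ a ≟ b ⌋

_□_ : Graph → Graph → Graph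
G □ H = mkGraph (n G * n H) (prodAdj G H)

-- Let k = γ(G) = Γ(G) and m = |V(H)|. Extending I ∪ {x}, where I witnesses that x is isolatable,
-- to a maximal independent set J gives a minimal dominating set, so |J| ≤ k; and J − x still
-- dominates every vertex other than x, because the neighbours of x are dominated by I. Hence, for
-- any vertex h₀ of H, ((J − x) × V(H)) ∪ ({x} × (V(H) − h₀)) dominates G □ H with fewer than k·m
-- vertices. On the other hand G, having no isolated vertices, has a minimum dominating set D in
-- which every vertex has an external private neighbour (Bollobás–Cockayne), and then D × V(H) is a
-- minimal dominating set of G □ H with k·m vertices. So γ(G □ H) < Γ(G □ H).

module Submission where

open import Defs
open import Level using (Level)
open import Data.Nat using (ℕ; suc; _+_; _*_; _≤_; _<_; z≤n; s≤s)
open import Data.Nat.Properties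
  using (module ≤-Reasoning; ≤-reflexive; ≤-trans; <-≤-trans; <-irrefl; +-suc; +-comm; m≤n+m;
         +-monoʳ-<; *-identityˡ; *-monoˡ-≤)
open import Data.Nat.Induction using (<-wellFounded)
open import Induction.WellFounded using (Acc; acc)
open import Data.Fin using (Fin; zero; suc; fromℕ<; _↑ˡ_; _↑ʳ_; combine; remQuot; quotRem)
  renaming (_≟_ to _≟ᶠ_)
open import Data.Fin.Properties
  using (any?; all?; ¬∀⟶∃¬; fromℕ<-injective; remQuot-combine; combine-remQuot)
open import Data.Fin.Subset
  using (Subset; inside; outside; _∈_; _∉_; ∣_∣; ⊥; ⊤; _∪_; _─_; _-_; ⁅_⁆; _⊆_; _⊂_)
open import Data.Fin.Subset.Properties
  using (_∈?_; ∉⊥; ∈⊤; ∣⊥∣≡0; ∣⊤∣≡n; ∣⁅x⁆∣≡1; x∈⁅x⁆; x∈⁅y⁆⇒x≡y; p⊆p∪q; q⊆p∪q; x∈p∪q⁻; p─q⊆p;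
         x∈p∧x≢y⇒x∈p-y; x∈p⇒∣p-x∣<∣p∣; p⊂q⇒∣p∣<∣q∣)
open import Data.Vec using ([]; _∷_; _++_; lookup; tabulate; here; there)
open import Data.Vec.Properties using ([]=⇒lookup; lookup⇒[]=; lookup-++ˡ; lookup-++ʳ; lookup∘tabulate)
open import Data.Bool using (true; false)
open import Data.Bool.Properties using (_≟_; ∨-zeroʳ)
open import Data.List using (List; []; _∷_; allFin)
open import Data.List.Relation.Unary.All as All using (All; []; _∷_)
open import Data.List.Membership.Propositional.Properties using (∈-allFin)
open import Data.Product using (∃; _×_; _,_; proj₁; proj₂; map₁; swap; uncurry)
open import Data.Sum using (_⊎_; inj₁; inj₂)
open import Data.Empty using (⊥-elim)
open import Function using (_∘_)
open import Relation.Binary.PropositionalEquality using (_≡_; _≢_; refl; sym; trans; cong; cong₂; subst)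
open import Relation.Nullary using (¬_; Dec; yes; no; does; contradiction)
open import Relation.Nullary.Decidable using (_×-dec_; _⊎-dec_; _→-dec_; ¬?; dec-true; decidable-stable)
open import Relation.Unary using (Pred; Decidable)

private variable
  ℓ : Level
  k l : ℕ
  x y : Fin l

x∈p─q⇒x∉q : ∀ (p q : Subset l) → x ∈ p ─ q → x ∉ q
x∈p─q⇒x∉q (_ ∷ p) (outside ∷ q) (there x∈) (there x∈q) = x∈p─q⇒x∉q p q x∈ x∈q
x∈p─q⇒x∉q (_ ∷ p) (inside ∷ q) (there x∈) (there x∈q) = x∈p─q⇒x∉q p q x∈ x∈q

∣p∪q∣≤∣p∣+∣q∣ : ∀ (p q : Subset l) → ∣ p ∪ q ∣ ≤ ∣ p ∣ + ∣ q ∣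
∣p∪q∣≤∣p∣+∣q∣ []            []            = z≤n
∣p∪q∣≤∣p∣+∣q∣ (outside ∷ p) (outside ∷ q) = ∣p∪q∣≤∣p∣+∣q∣ p q
∣p∪q∣≤∣p∣+∣q∣ (inside ∷ p)  (outside ∷ q) = s≤s (∣p∪q∣≤∣p∣+∣q∣ p q)
∣p∪q∣≤∣p∣+∣q∣ (outside ∷ p) (inside ∷ q)  =
  ≤-trans (s≤s (∣p∪q∣≤∣p∣+∣q∣ p q)) (≤-reflexive (sym (+-suc ∣ p ∣ ∣ q ∣)))
∣p∪q∣≤∣p∣+∣q∣ (inside ∷ p)  (inside ∷ q)  =
  s≤s (≤-trans (∣p∪q∣≤∣p∣+∣q∣ p q) (≤-trans (m≤n+m _ 1) (≤-reflexive (sym (+-suc ∣ p ∣ ∣ q ∣)))))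

∈-resp-lookup : ∀ {p : Subset k} {q : Subset l} {i j} → lookup p i ≡ lookup q j → i ∈ p → j ∈ q
∈-resp-lookup {q = q} {j = j} p[i]≡q[j] i∈p = lookup⇒[]= j q (trans (sym p[i]≡q[j]) ([]=⇒lookup i∈p))

module _ {p : Subset k} {q : Subset l} where

  ∈-++⁺ˡ : ∀ {i} → i ∈ p → i ↑ˡ l ∈ p ++ q
  ∈-++⁺ˡ = ∈-resp-lookup (sym (lookup-++ˡ p q _))

  ∈-++⁺ʳ : ∀ {j} → j ∈ q → k ↑ʳ j ∈ p ++ q
  ∈-++⁺ʳ = ∈-resp-lookup (sym (lookup-++ʳ p q _))

  ∈-++⁻ˡ : ∀ {i} → i ↑ˡ l ∈ p ++ q → i ∈ p
  ∈-++⁻ˡ = ∈-resp-lookup (lookup-++ˡ p q _)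

  ∈-++⁻ʳ : ∀ {j} → k ↑ʳ j ∈ p ++ q → j ∈ q
  ∈-++⁻ʳ = ∈-resp-lookup (lookup-++ʳ p q _)

select : {P : Pred (Fin l) ℓ} → Decidable P → Subset l
select P? = tabulate (does ∘ P?)

module _ {P : Pred (Fin l) ℓ} (P? : Decidable P) where

  ∈-select⁺ : P x → x ∈ select P?
  ∈-select⁺ {x = x} px = lookup⇒[]= x _ (trans (lookup∘tabulate (does ∘ P?) x) (dec-true (P? x) px))

  ∈-select⁻ : x ∈ select P? → P x
  ∈-select⁻ {x = x} x∈ with P? x | trans (sym (lookup∘tabulate (does ∘ P?) x)) ([]=⇒lookup x∈)
  ... | yes px | _ = px
  ... | no _   | ()

infixr 7 _⊠_
_⊠_ : Subset k → Subset l → Subset (k * l)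
[]            ⊠ q = []
(outside ∷ p) ⊠ q = ⊥ ++ p ⊠ q
(inside  ∷ p) ⊠ q = q ++ p ⊠ q

∣p++q∣≡∣p∣+∣q∣ : ∀ (p : Subset k) (q : Subset l) → ∣ p ++ q ∣ ≡ ∣ p ∣ + ∣ q ∣
∣p++q∣≡∣p∣+∣q∣ []            q = refl
∣p++q∣≡∣p∣+∣q∣ (outside ∷ p) q = ∣p++q∣≡∣p∣+∣q∣ p q
∣p++q∣≡∣p∣+∣q∣ (inside  ∷ p) q = cong suc (∣p++q∣≡∣p∣+∣q∣ p q)

∣p⊠q∣≡∣p∣*∣q∣ : ∀ (p : Subset k) (q : Subset l) → ∣ p ⊠ q ∣ ≡ ∣ p ∣ * ∣ q ∣
∣p⊠q∣≡∣p∣*∣q∣ []            q = refl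
∣p⊠q∣≡∣p∣*∣q∣ {l = l} (outside ∷ p) q =
  trans (∣p++q∣≡∣p∣+∣q∣ (⊥ {n = l}) (p ⊠ q)) (cong₂ _+_ (∣⊥∣≡0 l) (∣p⊠q∣≡∣p∣*∣q∣ p q))
∣p⊠q∣≡∣p∣*∣q∣ (inside  ∷ p) q =
  trans (∣p++q∣≡∣p∣+∣q∣ q (p ⊠ q)) (cong (∣ q ∣ +_) (∣p⊠q∣≡∣p∣*∣q∣ p q))

∈-⊠⁺ : ∀ {p : Subset k} {q : Subset l} {i j} → i ∈ p → j ∈ q → combine i j ∈ p ⊠ q
∈-⊠⁺ {p = inside  ∷ _} here        j∈q = ∈-++⁺ˡ j∈q
∈-⊠⁺ {p = outside ∷ _} (there i∈p) j∈q = ∈-++⁺ʳ (∈-⊠⁺ i∈p j∈q)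
∈-⊠⁺ {p = inside  ∷ _} (there i∈p) j∈q = ∈-++⁺ʳ (∈-⊠⁺ i∈p j∈q)

∈-⊠⁻ : ∀ (p : Subset k) {q : Subset l} i {j} → combine i j ∈ p ⊠ q → i ∈ p × j ∈ q
∈-⊠⁻ (inside  ∷ p) zero    ij∈ = here , ∈-++⁻ˡ ij∈
∈-⊠⁻ (outside ∷ p) zero    ij∈ = ⊥-elim (∉⊥ (∈-++⁻ˡ ij∈))
∈-⊠⁻ (inside  ∷ p) (suc i) ij∈ = map₁ there (∈-⊠⁻ p i (∈-++⁻ʳ ij∈))
∈-⊠⁻ (outside ∷ p) (suc i) ij∈ = map₁ there (∈-⊠⁻ p i (∈-++⁻ʳ ij∈))

x∈p-y⇒x≢y : ∀ {p : Subset l} → x ∈ p - y → x ≢ y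
x∈p-y⇒x≢y {y = y} {p = p} x∈p-y refl = x∈p─q⇒x∉q p ⁅ y ⁆ x∈p-y (x∈⁅x⁆ y)

p⊆q∧x∉p⇒p⊆q-x : ∀ {p q : Subset l} → p ⊆ q → x ∉ p → p ⊆ q - x
p⊆q∧x∉p⇒p⊆q-x p⊆q x∉p y∈p = x∈p∧x≢y⇒x∈p-y (p⊆q y∈p) λ { refl → x∉p y∈p }

∣p⊠⊤∪⁅x⁆⊠⊤-y∣<suc∣p∣*n : ∀ {k n} (p : Subset k) (x : Fin k) (y : Fin n) →
  ∣ p ⊠ ⊤ {n} ∪ ⁅ x ⁆ ⊠ (⊤ - y) ∣ < suc ∣ p ∣ * n
∣p⊠⊤∪⁅x⁆⊠⊤-y∣<suc∣p∣*n {n = n} p x y = begin-strict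
  ∣ p ⊠ ⊤ ∪ ⁅ x ⁆ ⊠ (⊤ - y) ∣          ≤⟨ ∣p∪q∣≤∣p∣+∣q∣ (p ⊠ ⊤) (⁅ x ⁆ ⊠ (⊤ - y)) ⟩
  ∣ p ⊠ ⊤ {n} ∣ + ∣ ⁅ x ⁆ ⊠ (⊤ - y) ∣    ≡⟨ cong₂ _+_ (∣p⊠q∣≡∣p∣*∣q∣ p ⊤) (∣p⊠q∣≡∣p∣*∣q∣ ⁅ x ⁆ (⊤ - y)) ⟩
  ∣ p ∣ * ∣ ⊤ {n} ∣ + ∣ ⁅ x ⁆ ∣ * ∣ ⊤ - y ∣ ≡⟨ cong₂ (λ a b → ∣ p ∣ * a + b * ∣ ⊤ - y ∣)
                                               (∣⊤∣≡n n) (∣⁅x⁆∣≡1 x) ⟩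
  ∣ p ∣ * n + 1 * ∣ ⊤ - y ∣              ≡⟨ cong (∣ p ∣ * n +_) (*-identityˡ ∣ ⊤ - y ∣) ⟩
  ∣ p ∣ * n + ∣ ⊤ - y ∣                  <⟨ +-monoʳ-< (∣ p ∣ * n) ∣⊤-y∣<n ⟩
  ∣ p ∣ * n + n                          ≡⟨ +-comm (∣ p ∣ * n) n ⟩
  suc ∣ p ∣ * n                          ∎
  where
  open ≤-Reasoning
  ∣⊤-y∣<n : ∣ ⊤ - y ∣ < n
  ∣⊤-y∣<n = <-≤-trans (x∈p⇒∣p-x∣<∣p∣ (∈⊤ {x = y})) (≤-reflexive (∣⊤∣≡n n))

data CombineView {m n : ℕ} : Fin (m * n) → Set where
  combined : (i : Fin m) (j : Fin n) → CombineView (combine i j)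

combineView : ∀ {m n} (k : Fin (m * n)) → CombineView k
combineView {m} {n} k = subst CombineView (combine-remQuot {m} n k) (uncurry combined (remQuot {m} n k))

module _ (G H : Graph) where

  private
    quotRem-combine : ∀ (g : Fin (n G)) (h : Fin (n H)) → quotRem {n G} (n H) (combine g h) ≡ (h , g)
    quotRem-combine g h = cong swap (remQuot-combine g h)

  □-adjˡ : ∀ {g g′} h → Adj G g g′ → Adj (G □ H) (combine g h) (combine g′ h)
  □-adjˡ {g} {g′} h g~g′ rewrite quotRem-combine g h | quotRem-combine g′ h with h ≟ᶠ h
  ... | yes _ rewrite g~g′ = ∨-zeroʳ _
  ... | no h≢h = contradiction refl h≢h

  □-adjʳ : ∀ g {h h′} → Adj H h h′ → Adj (G □ H) (combine g h) (combine g h′)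
  □-adjʳ g {h} {h′} h~h′ rewrite quotRem-combine g h | quotRem-combine g h′ with g ≟ᶠ g
  ... | yes _ rewrite h~h′ = refl
  ... | no g≢g = contradiction refl g≢g

  □-adj⁻ : ∀ {g g′ h h′} → Adj (G □ H) (combine g h) (combine g′ h′) →
           (g ≡ g′ × Adj H h h′) ⊎ (h ≡ h′ × Adj G g g′)
  □-adj⁻ {g} {g′} {h} {h′} gh~g′h′ rewrite quotRem-combine g h | quotRem-combine g′ h′
    with g ≟ᶠ g′ | h ≟ᶠ h′ | adj H h h′ | adj G g g′
  ... | yes g≡g′ | _        | true | _    = inj₁ (g≡g′ , refl)
  ... | _        | yes h≡h′ | _    | true = inj₂ (h≡h′ , refl)
  ... | yes _    | yes _    | false | false = contradiction gh~g′h′ λ ()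
  ... | yes _    | no _     | false | _     = contradiction gh~g′h′ λ ()
  ... | no _     | yes _    | _     | false = contradiction gh~g′h′ λ ()
  ... | no _     | no _     | _     | _     = contradiction gh~g′h′ λ ()

Dominates-mono : ∀ G {D D′ v} → D ⊆ D′ → Dominates G D v → Dominates G D′ v
Dominates-mono G D⊆D′ (inj₁ v∈D)            = inj₁ (D⊆D′ v∈D)
Dominates-mono G D⊆D′ (inj₂ (u , u∈D , u~v)) = inj₂ (u , D⊆D′ u∈D , u~v)

dominates? : ∀ G D → Decidable (Dominates G D)
dominates? G D v = v ∈? D ⊎-dec any? (λ u → u ∈? D ×-dec adj G u v ≟ true)

ExternalPrivateNeighbour : (G : Graph) → Subset (n G) → Fin (n G) → Fin (n G) → Set
ExternalPrivateNeighbour G D d p = p ∉ D × Adj G d p × ¬ Dominates G (D - d) p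

externalPrivateNeighbour? : ∀ G D d → Dec (∃ (ExternalPrivateNeighbour G D d))
externalPrivateNeighbour? G D d =
  any? λ p → ¬? (p ∈? D) ×-dec adj G d p ≟ true ×-dec ¬? (dominates? G (D - d) p)

MinimumDominating : (G : Graph) → Subset (n G) → Set
MinimumDominating G D = Dominating G D × (∀ D′ → Dominating G D′ → ∣ D ∣ ≤ ∣ D′ ∣)

IsDominationNumber⇒minimum : ∀ {G k} → IsDominationNumber G k → ∃ (MinimumDominating G)
IsDominationNumber⇒minimum ((D , dominating , ∣D∣≡k) , k≤) =
  D , dominating , λ D′ dominating′ → subst (_≤ ∣ D′ ∣) (sym ∣D∣≡k) (k≤ D′ dominating′)

Isolated : (G : Graph) → Subset (n G) → Fin (n G) → Set
Isolated G D v = v ∈ D × (∀ w → w ∈ D → ¬ Adj G w v)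

isolated? : ∀ G D → Decidable (Isolated G D)
isolated? G D v = v ∈? D ×-dec all? λ w → w ∈? D →-dec ¬? (adj G w v ≟ true)

isolatedVertices : (G : Graph) → Subset (n G) → Subset (n G)
isolatedVertices G D = select (isolated? G D)

module _ {G : Graph} where

  reach-distinct⇒neighbour : ∀ {v a b} → Reach G v a → Reach G v b → a ≢ b → ∃ (Adj G v)
  reach-distinct⇒neighbour (step v~u _) _            _   = _ , v~u
  reach-distinct⇒neighbour here         (step v~u _) _   = _ , v~u
  reach-distinct⇒neighbour here         here         a≢a = contradiction refl a≢a

  connected⇒neighbour : Connected G → 2 ≤ order G → ∀ v → ∃ (Adj G v)
  connected⇒neighbour connected 2≤n v =
    reach-distinct⇒neighbour (connected v (fromℕ< {0} 1≤n)) (connected v (fromℕ< 2≤n))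
      (λ 0≡1 → contradiction (fromℕ<-injective 0 1 1≤n 2≤n 0≡1) λ ())
    where
    1≤n : 1 ≤ n G
    1≤n = ≤-trans (s≤s z≤n) 2≤n

  independent-dominating⇒minimal : ∀ {D} → Independent G D → Dominating G D → MinimalDominating G D
  independent-dominating⇒minimal {D} independent dominating = dominating , not-proper
    where
    not-proper : ∀ D′ → D′ ⊊ D → ¬ Dominating G D′
    not-proper D′ (D′⊆D , d , d∈D , d∉D′) dominating′ with dominating′ d
    ... | inj₁ d∈D′             = d∉D′ d∈D′
    ... | inj₂ (u , u∈D′ , u~d) = independent u d (D′⊆D u u∈D′) d∈D u~d

  externalPrivate⇒minimal : ∀ {D} → Dominating G D →
    (∀ d → d ∈ D → ∃ (ExternalPrivateNeighbour G D d)) → MinimalDominating G D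
  externalPrivate⇒minimal {D} dominating has-private = dominating , not-proper
    where
    not-proper : ∀ D′ → D′ ⊊ D → ¬ Dominating G D′
    not-proper D′ (D′⊆D , d , d∈D , d∉D′) dominating′
      with p , _ , _ , p∉N[D-d] ← has-private d d∈D =
      p∉N[D-d] (Dominates-mono G (p⊆q∧x∉p⇒p⊆q-x (λ {y} → D′⊆D y) d∉D′) (dominating′ p))

module _ {G : Graph} (simple : Simple G) where

  Adj-sym : ∀ {u v} → Adj G u v → Adj G v u
  Adj-sym {u} {v} u~v = subst (_≡ true) (proj₁ simple u v) u~v

  Adj-irrefl : ∀ {v} → ¬ Adj G v v
  Adj-irrefl {v} v~v with () ← subst (_≡ true) (proj₂ simple v) v~v

  Adj⇒≢ : ∀ {u v} → Adj G u v → u ≢ v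
  Adj⇒≢ u~u refl = Adj-irrefl u~u

  Independent-∪⁅⁆ : ∀ {I v} → Independent G I → ¬ Dominates G I v → Independent G (I ∪ ⁅ v ⁆)
  Independent-∪⁅⁆ {I} {v} independent v∉N[I] u w u∈ w∈ u~w
    with x∈p∪q⁻ I ⁅ v ⁆ u∈ | x∈p∪q⁻ I ⁅ v ⁆ w∈
  ... | inj₁ u∈I | inj₁ w∈I = independent u w u∈I w∈I u~w
  ... | inj₁ u∈I | inj₂ w∈v with refl ← x∈⁅y⁆⇒x≡y v w∈v = v∉N[I] (inj₂ (u , u∈I , u~w))
  ... | inj₂ u∈v | inj₁ w∈I with refl ← x∈⁅y⁆⇒x≡y v u∈v = v∉N[I] (inj₂ (w , w∈I , Adj-sym u~w))
  ... | inj₂ u∈v | inj₂ w∈v with refl ← x∈⁅y⁆⇒x≡y v u∈v | refl ← x∈⁅y⁆⇒x≡y v w∈v = Adj-irrefl u~w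

  extend-independent-dominating : ∀ {I} (vs : List (Fin (n G))) → Independent G I →
    ∃ λ J → I ⊆ J × Independent G J × All (Dominates G J) vs
  extend-independent-dominating {I} [] independent = I , (λ i∈I → i∈I) , independent , []
  extend-independent-dominating (v ∷ vs) independent
    with extend-independent-dominating vs independent
  ... | J , I⊆J , independentJ , dominated with dominates? G J v
  ... | yes v∈N[J] = J , I⊆J , independentJ , v∈N[J] ∷ dominated
  ... | no  v∉N[J] =
    J ∪ ⁅ v ⁆ , p⊆p∪q ⁅ v ⁆ ∘ I⊆J , Independent-∪⁅⁆ independentJ v∉N[J] ,
    inj₁ (q⊆p∪q J ⁅ v ⁆ (x∈⁅x⁆ v)) ∷ All.map (Dominates-mono G (p⊆p∪q ⁅ v ⁆)) dominated

  independent⇒⊆-independent-dominating : ∀ {I} → Independent G I →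
    ∃ λ J → I ⊆ J × Independent G J × Dominating G J
  independent⇒⊆-independent-dominating independent
    with J , I⊆J , independentJ , dominated ← extend-independent-dominating (allFin _) independent =
    J , I⊆J , independentJ , λ v → All.lookup dominated (∈-allFin v)

  minimum∧nonisolated⇒externalPrivate : ∀ {D d w} → MinimumDominating G D → d ∈ D → w ∈ D → Adj G w d →
    ∃ (ExternalPrivateNeighbour G D d)
  minimum∧nonisolated⇒externalPrivate {D} {d} {w} (dominating , minimum) d∈D w∈D w~d =
    p , p∉D , d~p , p∉N[D-d]
    where
    D-d-not-dominating : ¬ Dominating G (D - d)
    D-d-not-dominating dominating′ = <-irrefl refl (<-≤-trans (x∈p⇒∣p-x∣<∣p∣ d∈D) (minimum _ dominating′))
    undominated : ∃ λ p → ¬ Dominates G (D - d) p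
    undominated = ¬∀⟶∃¬ _ _ (dominates? G (D - d)) D-d-not-dominating
    p = proj₁ undominated
    p∉N[D-d] = proj₂ undominated
    p∉D : p ∉ D
    p∉D p∈D with p ≟ᶠ d
    ... | yes p≡d  = p∉N[D-d] (inj₂ (w , x∈p∧x≢y⇒x∈p-y w∈D (Adj⇒≢ w~d) , subst (Adj G w) (sym p≡d) w~d))
    ... | no  p≢d  = p∉N[D-d] (inj₁ (x∈p∧x≢y⇒x∈p-y p∈D p≢d))
    d~p : Adj G d p
    d~p with dominating p
    ... | inj₁ p∈D = contradiction p∈D p∉D
    ... | inj₂ (u , u∈D , u~p) with u ≟ᶠ d
    ...   | yes refl = u~p
    ...   | no  u≢d  = contradiction (inj₂ (u , x∈p∧x≢y⇒x∈p-y u∈D u≢d , u~p)) p∉N[D-d]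

  -- Bollobás–Cockayne exchange: a vertex d of a minimum dominating set D without external private
  -- neighbour has no neighbour in D, so trading it for any neighbour u keeps D minimum dominating and
  -- strictly shrinks the set of isolated vertices of D.
  module Exchange (no-isolated : ∀ v → ∃ (Adj G v)) {D d} (minimum : MinimumDominating G D) (d∈D : d ∈ D)
                  (no-private : ¬ ∃ (ExternalPrivateNeighbour G D d)) where

    d-isolated : ∀ w → w ∈ D → ¬ Adj G w d
    d-isolated w w∈D w~d = no-private (minimum∧nonisolated⇒externalPrivate minimum d∈D w∈D w~d)

    neighbour-of-d⇒dominated : ∀ {v} → Adj G d v → Dominates G (D - d) v
    neighbour-of-d⇒dominated {v} d~v with v ∈? D
    ... | yes v∈D = contradiction (Adj-sym d~v) (d-isolated v v∈D)
    ... | no  v∉D = decidable-stable (dominates? G (D - d) v)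
                      λ v∉N[D-d] → no-private (v , v∉D , d~v , v∉N[D-d])

    u : Fin (n G)
    u = proj₁ (no-isolated d)

    d~u : Adj G d u
    d~u = proj₂ (no-isolated d)

    D′ : Subset (n G)
    D′ = (D - d) ∪ ⁅ u ⁆

    u∈D′ : u ∈ D′
    u∈D′ = q⊆p∪q (D - d) ⁅ u ⁆ (x∈⁅x⁆ u)

    D-d⊆D′ : D - d ⊆ D′
    D-d⊆D′ = p⊆p∪q ⁅ u ⁆

    u-has-neighbour-in-D′ : ∃ λ w → w ∈ D′ × Adj G w u
    u-has-neighbour-in-D′ with neighbour-of-d⇒dominated d~u
    ... | inj₁ u∈D-d              = contradiction (Adj-sym d~u) (d-isolated u (p─q⊆p D ⁅ d ⁆ u∈D-d))
    ... | inj₂ (w , w∈D-d , w~u) = w , D-d⊆D′ w∈D-d , w~u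

    D′-dominating : Dominating G D′
    D′-dominating v with proj₁ minimum v
    ... | inj₁ v∈D with v ≟ᶠ d
    ...   | yes refl = inj₂ (u , u∈D′ , Adj-sym d~u)
    ...   | no  v≢d  = inj₁ (D-d⊆D′ (x∈p∧x≢y⇒x∈p-y v∈D v≢d))
    D′-dominating v | inj₂ (w , w∈D , w~v) with w ≟ᶠ d
    ...   | yes refl = Dominates-mono G D-d⊆D′ (neighbour-of-d⇒dominated w~v)
    ...   | no  w≢d  = inj₂ (w , D-d⊆D′ (x∈p∧x≢y⇒x∈p-y w∈D w≢d) , w~v)

    ∣D′∣≤∣D∣ : ∣ D′ ∣ ≤ ∣ D ∣
    ∣D′∣≤∣D∣ = begin
      ∣ (D - d) ∪ ⁅ u ⁆ ∣    ≤⟨ ∣p∪q∣≤∣p∣+∣q∣ (D - d) ⁅ u ⁆ ⟩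
      ∣ D - d ∣ + ∣ ⁅ u ⁆ ∣  ≡⟨ cong (∣ D - d ∣ +_) (∣⁅x⁆∣≡1 u) ⟩
      ∣ D - d ∣ + 1          ≡⟨ +-comm ∣ D - d ∣ 1 ⟩
      suc ∣ D - d ∣          ≤⟨ x∈p⇒∣p-x∣<∣p∣ d∈D ⟩
      ∣ D ∣                  ∎
      where open ≤-Reasoning

    D′-minimum : MinimumDominating G D′
    D′-minimum = D′-dominating , λ D″ dominating″ → ≤-trans ∣D′∣≤∣D∣ (proj₂ minimum D″ dominating″)

    isolated-shrink : isolatedVertices G D′ ⊂ isolatedVertices G D
    isolated-shrink =
      shrinks , d , ∈-select⁺ (isolated? G D) (d∈D , d-isolated) , d-not-isolated ∘ ∈-select⁻ (isolated? G D′)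
      where
      shrinks : isolatedVertices G D′ ⊆ isolatedVertices G D
      shrinks {v} v∈ with ∈-select⁻ (isolated? G D′) v∈
      ... | v∈D′ , v-isolated with x∈p∪q⁻ (D - d) ⁅ u ⁆ v∈D′
      ...   | inj₂ v∈⁅u⁆ with refl ← x∈⁅y⁆⇒x≡y u v∈⁅u⁆ =
        let w , w∈D′ , w~u = u-has-neighbour-in-D′ in contradiction w~u (v-isolated w w∈D′)
      ...   | inj₁ v∈D-d = ∈-select⁺ (isolated? G D) (p─q⊆p D ⁅ d ⁆ v∈D-d , isolated-in-D)
        where
        isolated-in-D : ∀ w → w ∈ D → ¬ Adj G w v
        isolated-in-D w w∈D w~v with w ≟ᶠ d
        ... | yes refl = d-isolated v (p─q⊆p D ⁅ d ⁆ v∈D-d) (Adj-sym w~v)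
        ... | no  w≢d  = v-isolated w (D-d⊆D′ (x∈p∧x≢y⇒x∈p-y w∈D w≢d)) w~v
      d-not-isolated : ¬ Isolated G D′ d
      d-not-isolated (d∈D′ , _) with x∈p∪q⁻ (D - d) ⁅ u ⁆ d∈D′
      ... | inj₁ d∈D-d = x∈p-y⇒x≢y d∈D-d refl
      ... | inj₂ d∈⁅u⁆ = Adj⇒≢ d~u (x∈⁅y⁆⇒x≡y u d∈⁅u⁆)

  minimum⇒externalPrivate-minimum : (∀ v → ∃ (Adj G v)) → ∀ {D} → MinimumDominating G D →
    ∃ λ D′ → MinimumDominating G D′ × (∀ d → d ∈ D′ → ∃ (ExternalPrivateNeighbour G D′ d))
  minimum⇒externalPrivate-minimum no-isolated minimum = go minimum (<-wellFounded _)
    where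
    hasPrivate? : ∀ D → Decidable λ d → d ∈ D → ∃ (ExternalPrivateNeighbour G D d)
    hasPrivate? D d = d ∈? D →-dec externalPrivateNeighbour? G D d

    go : ∀ {D} → MinimumDominating G D → Acc _<_ ∣ isolatedVertices G D ∣ →
      ∃ λ D′ → MinimumDominating G D′ × (∀ d → d ∈ D′ → ∃ (ExternalPrivateNeighbour G D′ d))
    go {D} minimum (acc smaller) with all? (hasPrivate? D)
    ... | yes all-private = D , minimum , all-private
    ... | no  ¬all-private with d , ¬private ← ¬∀⟶∃¬ _ _ (hasPrivate? D) ¬all-private =
      go D′-minimum (smaller (p⊂q⇒∣p∣<∣q∣ isolated-shrink))
      where
      d∈D : d ∈ D
      d∈D = decidable-stable (d ∈? D) λ d∉D → ¬private λ d∈D → contradiction d∈D d∉D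
      open Exchange no-isolated minimum d∈D (λ epn → ¬private λ _ → epn)

  isolatable⇒dominating-except : ∀ {x} → Isolatable G x →
    ∃ λ J → MinimalDominating G J × x ∈ J × (∀ g → g ≢ x → Dominates G (J - x) g)
  isolatable⇒dominating-except {x} (I , independent , x∉N[I] , N[x]⊆N[I])
    with J , I∪x⊆J , independentJ , dominatingJ
           ← independent⇒⊆-independent-dominating (Independent-∪⁅⁆ independent x∉N[I]) =
    J , independent-dominating⇒minimal independentJ dominatingJ , x∈J , dominates-except
    where
    x∈J : x ∈ J
    x∈J = I∪x⊆J (q⊆p∪q I ⁅ x ⁆ (x∈⁅x⁆ x))
    I⊆J-x : I ⊆ J - x
    I⊆J-x = p⊆q∧x∉p⇒p⊆q-x (I∪x⊆J ∘ p⊆p∪q ⁅ x ⁆) (x∉N[I] ∘ inj₁)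
    dominates-except : ∀ g → g ≢ x → Dominates G (J - x) g
    dominates-except g g≢x with dominatingJ g
    ... | inj₁ g∈J = inj₁ (x∈p∧x≢y⇒x∈p-y g∈J g≢x)
    ... | inj₂ (j , j∈J , j~g) with j ≟ᶠ x
    ...   | yes refl = Dominates-mono G I⊆J-x (N[x]⊆N[I] g j~g)
    ...   | no  j≢x  = inj₂ (j , x∈p∧x≢y⇒x∈p-y j∈J j≢x , j~g)

module _ {G : Graph} (H : Graph) where

  ⊠⊤-dominates : ∀ {D g} → Dominates G D g → ∀ h → Dominates (G □ H) (D ⊠ ⊤) (combine g h)
  ⊠⊤-dominates (inj₁ g∈D)            h = inj₁ (∈-⊠⁺ g∈D ∈⊤)
  ⊠⊤-dominates (inj₂ (w , w∈D , w~g)) h = inj₂ (combine w h , ∈-⊠⁺ w∈D ∈⊤ , □-adjˡ G H h w~g)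

  ⊠⊤-dominating : ∀ {D} → Dominating G D → Dominating (G □ H) (D ⊠ ⊤)
  ⊠⊤-dominating dominating gh with combined g h ← combineView {n G} gh = ⊠⊤-dominates (dominating g) h

  ⊠⊤-externalPrivate : ∀ {D d p} → ExternalPrivateNeighbour G D d p →
    ∀ h → ExternalPrivateNeighbour (G □ H) (D ⊠ ⊤) (combine d h) (combine p h)
  ⊠⊤-externalPrivate {D} {d} {p} (p∉D , d~p , p∉N[D-d]) h = p∉D ∘ in-D , □-adjˡ G H h d~p , ph∉N
    where
    in-D : ∀ {g h} → combine g h ∈ D ⊠ ⊤ → g ∈ D
    in-D {g} gh∈ = proj₁ (∈-⊠⁻ D g gh∈)
    ph∉N : ¬ Dominates (G □ H) (D ⊠ ⊤ - combine d h) (combine p h)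
    ph∉N (inj₁ ph∈) = p∉D (in-D (p─q⊆p _ _ ph∈))
    ph∉N (inj₂ (k , k∈ , k~ph)) with combined w h′ ← combineView {n G} k | □-adj⁻ G H k~ph
    ... | inj₁ (refl , _)   = p∉D (in-D (p─q⊆p _ _ k∈))
    ... | inj₂ (refl , w~p) =
      p∉N[D-d] (inj₂ (w , x∈p∧x≢y⇒x∈p-y (in-D (p─q⊆p _ _ k∈)) (λ { refl → x∈p-y⇒x≢y k∈ refl }) , w~p))

  ⊠⊤-minimal : ∀ {D} → Dominating G D → (∀ d → d ∈ D → ∃ (ExternalPrivateNeighbour G D d)) →
    MinimalDominating (G □ H) (D ⊠ ⊤)
  ⊠⊤-minimal {D} dominating private-neighbour =
    externalPrivate⇒minimal (⊠⊤-dominating dominating) λ dh dh∈ → lift dh dh∈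
    where
    lift : ∀ dh → dh ∈ D ⊠ ⊤ → ∃ (ExternalPrivateNeighbour (G □ H) (D ⊠ ⊤) dh)
    lift dh dh∈ with combined d h ← combineView {n G} dh
      with p , p-private ← private-neighbour d (proj₁ (∈-⊠⁻ D d dh∈)) =
      combine p h , ⊠⊤-externalPrivate p-private h

  ⊠-dominating-except : ∀ {S x h₀ h₁} → (∀ g → g ≢ x → Dominates G S g) → Simple H → Adj H h₀ h₁ →
    Dominating (G □ H) (S ⊠ ⊤ ∪ ⁅ x ⁆ ⊠ (⊤ - h₀))
  ⊠-dominating-except {S} {x} {h₀} {h₁} S-dominates simpleH h₀~h₁ gh
    with combined g h ← combineView {n G} gh
    with g ≟ᶠ x
  ... | no g≢x = Dominates-mono (G □ H) (p⊆p∪q _) (⊠⊤-dominates (S-dominates g g≢x) h)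
  ... | yes refl with h ≟ᶠ h₀
  ...   | no  h≢h₀ = inj₁ (q⊆p∪q (S ⊠ ⊤) _ (∈-⊠⁺ (x∈⁅x⁆ x) (x∈p∧x≢y⇒x∈p-y ∈⊤ h≢h₀)))
  ...   | yes refl = inj₂ (combine x h₁ ,
                           q⊆p∪q (S ⊠ ⊤) _ (∈-⊠⁺ (x∈⁅x⁆ x) (x∈p∧x≢y⇒x∈p-y ∈⊤ (Adj⇒≢ simpleH h₀~h₁ ∘ sym))) ,
                           □-adjʳ G H x (Adj-sym simpleH h₀~h₁))

  isolatable⇒small-□-dominating : ∀ {k x h₀ h₁} → Simple G → Simple H → Adj H h₀ h₁ →
    (∀ D → MinimalDominating G D → ∣ D ∣ ≤ k) → Isolatable G x →
    ∃ λ D → Dominating (G □ H) D × ∣ D ∣ < k * n H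
  isolatable⇒small-□-dominating {k} {x} {h₀} simpleG simpleH h₀~h₁ minimal≤k x-isolatable
    with J , J-minimal , x∈J , J-x-dominates ← isolatable⇒dominating-except simpleG x-isolatable =
    _ , ⊠-dominating-except J-x-dominates simpleH h₀~h₁ , (begin-strict
      ∣ (J - x) ⊠ ⊤ ∪ ⁅ x ⁆ ⊠ (⊤ - h₀) ∣  <⟨ ∣p⊠⊤∪⁅x⁆⊠⊤-y∣<suc∣p∣*n (J - x) x h₀ ⟩
      suc ∣ J - x ∣ * n H                ≤⟨ *-monoˡ-≤ (n H) ∣J-x∣<k ⟩
      k * n H                            ∎)
    where
    open ≤-Reasoning
    ∣J-x∣<k : ∣ J - x ∣ < k
    ∣J-x∣<k = <-≤-trans (x∈p⇒∣p-x∣<∣p∣ x∈J) (minimal≤k J J-minimal)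

  domination-number⇒large-□-minimal : ∀ {k} → Simple G → (∀ g → ∃ (Adj G g)) → IsDominationNumber G k →
    ∃ λ D → MinimalDominating (G □ H) D × k * n H ≤ ∣ D ∣
  domination-number⇒large-□-minimal {k} simpleG no-isolated γ≡k
    with D , (D-dominating , _) , D-private
           ← minimum⇒externalPrivate-minimum simpleG no-isolated (proj₂ (IsDominationNumber⇒minimum γ≡k)) =
    D ⊠ ⊤ , ⊠⊤-minimal D-dominating D-private , (begin
      k * n H              ≤⟨ *-monoˡ-≤ (n H) (proj₂ γ≡k D D-dominating) ⟩
      ∣ D ∣ * n H          ≡⟨ cong (∣ D ∣ *_) (∣⊤∣≡n (n H)) ⟨
      ∣ D ∣ * ∣ ⊤ {n H} ∣  ≡⟨ ∣p⊠q∣≡∣p∣*∣q∣ D ⊤ ⟨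
      ∣ D ⊠ ⊤ ∣            ∎)
    where open ≤-Reasoning

corollary3 : (G H : Graph) → Simple G → Simple H
    → Connected G → WellDominated G → 2 ≤ order G → (∃ λ x → Isolatable G x)
    → Connected H → 2 ≤ order H
    → ¬ WellDominated (G □ H)
corollary3 G H simpleG simpleH connectedG (k , γ≡k , Γ≡k) 2≤∣G∣ (x , x-isolatable) connectedH 2≤∣H∣
           (K , (_ , K≤dominating) , (_ , minimal≤K))
  with _ , h₀~h₁ ← connected⇒neighbour connectedH 2≤∣H∣ (fromℕ< 2≤∣H∣)
     | D′ , D′-minimal , k*m≤∣D′∣
         ← domination-number⇒large-□-minimal H simpleG (connected⇒neighbour connectedG 2≤∣G∣) γ≡k
  with D , D-dominating , ∣D∣<k*m
         ← isolatable⇒small-□-dominating H simpleG simpleH h₀~h₁ (proj₂ Γ≡k) x-isolatable =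
  <-irrefl refl (begin-strict
    K        ≤⟨ K≤dominating D D-dominating ⟩
    ∣ D ∣    <⟨ ∣D∣<k*m ⟩
    k * n H  ≤⟨ k*m≤∣D′∣ ⟩
    ∣ D′ ∣   ≤⟨ minimal≤K D′ D′-minimal ⟩
    K        ∎)
  where open ≤-Reasoning
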